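{- Let $G$ be an oriented graph derived from a Burling tree $T$ whose underlying graph is a dumbbell with holes $H,H'$ and path $P=x\dots x'$. Then either $x$ is not a subordinate vertex of $H$, or $x'$ is not a subordinate vertex of $H'$.
   Context: Rooted trees: for a rooted tree $(T,r)$ and $v\neq r$, $p(v)$ is the parent of $v$. A branch is a path $v_1v_2\dots v_k$ of $T$ with $v_i$ the parent of $v_{i+1}$ for all $i$ (it starts at $v_1$); a branch may be empty. Ancestors of $v$ are vertices on the path from $v$ to the root (including $v$); strict = other than $v$. A Burling tree is a 4-tuple $(T,r,\ell,c)$ where $T$ is a rooted tree with root $r$; $\ell$ assigns to every non-leaf vertex $v$ one of its children $\ell(v)$, the last-born of $v$; and $c$ is a function on $V(T)$ such that if $v\neq r$ is not a last-born then $c(v)$ is the vertex set of a (possibly empty) branch of $T$ starting at $\ell(p(v))$, while $c(v)=\varnothing$ if $v$ is the root or a last-born. The oriented graph fully derived from the Burling tree has vertex set $V(T)$ and an arc $uv$ iff $v\in c(u)$. An oriented graph is derived from the Burling tree if it is an induced subgraph of the fully derived oriented graph. A hole is an induced subgraph whose underlying graph is a cycle of length at least $4$. For a hole $H$ of $G$, let $S_H$ be the set of vertices $x$ of $H$ such that no strict ancestor of $x$ in $T$ lies in $H$. It is a fact that $H[S_H]$ consists of a vertex $p$ and two vertices $a,a'$ with arcs $ap,a'p$; $p$ is the pivot of $H$ and $a,a'$ are its antennas. A subordinate vertex of $H$ is a vertex of $H$ other than its pivot and its antennas. A dumbbell is a graph consisting of a path $P=x\dots x'$ (possibly $x=x'$),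 a hole $H$ through $x$ and a hole $H'$ through $x'$, such that $V(H)\cap V(P)=\{x\}$, $V(H')\cap V(P)=\{x'\}$, $V(H)\cap V(H')=\{x\}\cap\{x'\}$, and there are no edges other than those of $P$, $H$ and $H'$. -}

module Defs where

open import Data.Nat using (ℕ; zero; suc; _≤_)
open import Data.Fin using (Fin; toℕ)
open import Data.Maybe using (Maybe; just; nothing)
open import Data.Product using (Σ; ∃; _×_; _,_)
open import Data.Sum using (_⊎_)
open import Relation.Nullary using (¬_)
open import Relation.Binary.PropositionalEquality using (_≡_; _≢_)
open import Function.Bundles using (_⇔_)
open import Function.Definitions using (Injective)

-- A depth function that
-- strictly decreases along the parent map guarantees acyclicity, so
-- every vertex reaches the root (the structure is a rooted tree).
--
-- `last v` is the last-born ℓ(v) of a non-leaf v (nothing for leaves).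
--
-- c(v) is the vertex set of a (possibly empty) branch starting at
-- ℓ(p(v)).  A non-empty branch starting at ℓ(p(v)) is determined by its
-- bottom vertex b (a descendant of ℓ(p(v))), so c is encoded by
-- `cb : Fin n → Maybe (Fin n)` : nothing = empty branch, just b = the
-- branch from ℓ(p(v)) down to b.

data Anc {n : ℕ} (par : Fin n → Maybe (Fin n)) : Fin n → Fin n → Set where
  here : ∀ {v} → Anc par v v
  up   : ∀ {u v w} → par v ≡ just w → Anc par u w → Anc par u v

record BurlingTree (n : ℕ) : Set where
  field
    root        : Fin n
    par         : Fin n → Maybe (Fin n)
    depth       : Fin n → ℕ
    par-root    : par root ≡ nothing
    par-nothing : ∀ v → par v ≡ nothing → v ≡ root
    par-depth   : ∀ v u → par v ≡ just u → depth v ≡ suc (depth u)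
    last        : Fin n → Maybe (Fin n)
    last-child  : ∀ v u → last v ≡ just u → par u ≡ just v
    last-exists : ∀ v u → par u ≡ just v → ∃ λ w → last v ≡ just w
    cb          : Fin n → Maybe (Fin n)
    cb-empty  : ∀ v → (v ≡ root ⊎ (∃ λ u → last u ≡ just v)) → cb v ≡ nothing
    cb-branch : ∀ v b → cb v ≡ just b →
                Σ (Fin n) λ u → Σ (Fin n) λ l →
                  par v ≡ just u × last u ≡ just l × Anc par l b

  StrictAnc : Fin n → Fin n → Set
  StrictAnc u v = Anc par u v × u ≢ v

  InC : Fin n → Fin n → Set
  InC v w = Σ (Fin n) λ b → Σ (Fin n) λ u → Σ (Fin n) λ l →
              cb v ≡ just b × par v ≡ just u × last u ≡ just l ×
              Anc par l w × Anc par w b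

  Arc : Fin n → Fin n → Set
  Arc u v = InC u v

  Adj : Fin n → Fin n → Set
  Adj u v = Arc u v ⊎ Arc v u

record Seq (n : ℕ) : Set where
  field
    len  : ℕ
    vert : Fin len → Fin n

open Seq public

InSeq : ∀ {n} → Seq n → Fin n → Set
InSeq s v = ∃ λ i → vert s i ≡ v

CycNext : (k : ℕ) → Fin k → Fin k → Set
CycNext k i j = suc (toℕ i) ≡ toℕ j ⊎ (suc (toℕ i) ≡ k × toℕ j ≡ 0)

PathNext : (k : ℕ) → Fin k → Fin k → Set
PathNext k i j = suc (toℕ i) ≡ toℕ j

CycEdge : ∀ {n} → Seq n → Fin n → Fin n → Set
CycEdge s u v = ∃ λ i → ∃ λ j →
  (CycNext (len s) i j ⊎ CycNext (len s) j i) × vert s i ≡ u × vert s j ≡ v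

PathEdge : ∀ {n} → Seq n → Fin n → Fin n → Set
PathEdge s u v = ∃ λ i → ∃ λ j →
  (PathNext (len s) i j ⊎ PathNext (len s) j i) × vert s i ≡ u × vert s j ≡ v

IsCycle≥4 : ∀ {n} → Seq n → Set
IsCycle≥4 s = 4 ≤ len s × Injective _≡_ _≡_ (vert s)

IsPathFromTo : ∀ {n} → Seq n → Fin n → Fin n → Set
IsPathFromTo s x x' = Injective _≡_ _≡_ (vert s) ×
  Σ ℕ λ m → Σ (len s ≡ suc m) λ eq →
    (∀ i → toℕ i ≡ 0 → vert s i ≡ x) × (∀ i → toℕ i ≡ m → vert s i ≡ x')

module _ {n : ℕ} (T : BurlingTree n) where
  open BurlingTree T

  -- The oriented graph G derived from T is the induced subgraph of the
  -- fully derived graph on the vertex set V : Fin n → Set.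
  IsDumbbell : (V : Fin n → Set) → Seq n → Seq n → Seq n →
               Fin n → Fin n → Set
  IsDumbbell V H P H' x x' =
    IsCycle≥4 H × IsCycle≥4 H' × IsPathFromTo P x x' ×
    InSeq H x × InSeq H' x' ×
    (∀ v → V v ⇔ (InSeq H v ⊎ InSeq P v ⊎ InSeq H' v)) ×
    (∀ v → InSeq H v → InSeq P v → v ≡ x) ×
    (∀ v → InSeq H' v → InSeq P v → v ≡ x') ×
    (∀ v → InSeq H v → InSeq H' v → v ≡ x × v ≡ x') ×
    (∀ u v → V u → V v →
       Adj u v ⇔ (CycEdge H u v ⊎ PathEdge P u v ⊎ CycEdge H' u v))

  InSH : Seq n → Fin n → Set
  InSH H x = InSeq H x × (∀ y → InSeq H y → StrictAnc y x → ⊥)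
    where open import Data.Empty using (⊥)

  PivotAntennas : Seq n → Fin n → Fin n → Fin n → Set
  PivotAntennas H p a a' =
    p ≢ a × p ≢ a' × a ≢ a' ×
    (∀ v → InSH H v ⇔ (v ≡ p ⊎ v ≡ a ⊎ v ≡ a')) ×
    Arc a p × Arc a' p

  Subordinate : Seq n → Fin n → Set
  Subordinate H x = InSeq H x ×
    Σ (Fin n) λ p → Σ (Fin n) λ a → Σ (Fin n) λ a' →
      PivotAntennas H p a a' × x ≢ p × x ≢ a × x ≢ a'

module Submission where

open import Defs
open import Data.Nat using (ℕ; zero; suc; _≤_; _<_; _<?_; s≤s; z≤n)
open import Data.Nat.Properties
  using (≤-refl; <⇒≤; <⇒≱; <-irrefl; <-asym; n<1+n; ≤-<-trans; <-≤-trans)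
open import Data.Fin using (Fin; toℕ; fromℕ<)
open import Data.Fin.Properties using (toℕ-fromℕ<; toℕ-injective; toℕ<n; any?; all?)
open import Data.Maybe using (just)
open import Data.Maybe.Properties using (just-injective)
open import Data.Product using (Σ; ∃; _×_; _,_; proj₁; proj₂)
open import Data.Sum using (_⊎_; inj₁; inj₂; [_,_]′; swap)
open import Data.Empty using (⊥-elim)
open import Function using (_∘_)
open import Function.Bundles using (_⇔_; mk⇔; Equivalence)
open import Relation.Nullary using (¬_; Dec; yes; no)
open import Relation.Binary.PropositionalEquality using (_≡_; refl; sym; trans; cong; subst)

-- If x is subordinate in H, some t ∈ H is a strict ancestor of x in T. In a
-- Burling tree, a strict ancestor t of z is a strict ancestor of every
-- neighbour y of z, unless y → t is an arc. Such an arc would join P ∪ H' to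
-- H away from the cut vertex x, so walking from x along P and around H'
-- shows that t is strictly shallower than every vertex of H'. If x' were
-- also subordinate in H', some vertex of H' would symmetrically be shallower
-- than all of H. Comparing depths decides which side to refute.

spread : ∀ {L} (Q : Fin L → Set) →
  (∀ i j → PathNext L i j → Q i → Q j) →
  (∀ i j → PathNext L i j → Q j → Q i) →
  ∀ i → Q i → ∀ j → Q j
spread {L} Q forward backward i qi j =
  fromZero (toℕ j) (toZero (toℕ i) (toℕ<n i) atI) j refl
  where
  AtIndex : ℕ → Set
  AtIndex m = ∀ k → toℕ k ≡ m → Q k

  atI : AtIndex (toℕ i)
  atI k k≡i = subst Q (sym (toℕ-injective k≡i)) qi

  ascend : ∀ m → AtIndex m → AtIndex (suc m)
  ascend m q k k≡ = forward (fromℕ< m<L) k step (q (fromℕ< m<L) (toℕ-fromℕ< m<L))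
    where
    m<L : m < L
    m<L = <⇒≤ (subst (_< L) k≡ (toℕ<n k))
    step : PathNext L (fromℕ< m<L) k
    step = trans (cong suc (toℕ-fromℕ< m<L)) (sym k≡)

  descend : ∀ m → suc m < L → AtIndex (suc m) → AtIndex m
  descend m 1+m<L q k k≡ = backward k (fromℕ< 1+m<L) step (q (fromℕ< 1+m<L) (toℕ-fromℕ< 1+m<L))
    where
    step : PathNext L k (fromℕ< 1+m<L)
    step = trans (cong suc k≡) (sym (toℕ-fromℕ< 1+m<L))

  toZero : ∀ m → m < L → AtIndex m → AtIndex 0
  toZero zero    _     q = q
  toZero (suc m) 1+m<L q = toZero m (<⇒≤ 1+m<L) (descend m 1+m<L q)

  fromZero : ∀ m → AtIndex 0 → AtIndex m
  fromZero zero    q = q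
  fromZero (suc m) q = ascend m (fromZero m q)

mirror : ∀ {a b c} {A : Set a} {B : Set b} {C : Set c} → A ⊎ B ⊎ C → C ⊎ B ⊎ A
mirror = [ inj₂ ∘ inj₂ , [ inj₂ ∘ inj₁ , inj₁ ]′ ]′

module _ {n : ℕ} where

  CycEdge-ends : ∀ {s : Seq n} {u v} → CycEdge s u v → InSeq s u × InSeq s v
  CycEdge-ends (i , j , _ , refl , refl) = (i , refl) , (j , refl)

  PathEdge-ends : ∀ {s : Seq n} {u v} → PathEdge s u v → InSeq s u × InSeq s v
  PathEdge-ends (i , j , _ , refl , refl) = (i , refl) , (j , refl)

module _ {n : ℕ} (T : BurlingTree n) where
  open BurlingTree T

  par-functional : ∀ {v a b} → par v ≡ just a → par v ≡ just b → a ≡ b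
  par-functional e e' = just-injective (trans (sym e) e')

  depth-par : ∀ {v u} → par v ≡ just u → depth u < depth v
  depth-par {v} {u} e = subst (depth u <_) (sym (par-depth v u e)) (n<1+n (depth u))

  Anc-depth : ∀ {a b} → Anc par a b → depth a ≤ depth b
  Anc-depth here     = ≤-refl
  Anc-depth (up e r) = <⇒≤ (≤-<-trans (Anc-depth r) (depth-par e))

  Anc-trans : ∀ {a b c} → Anc par a b → Anc par b c → Anc par a c
  Anc-trans r here     = r
  Anc-trans r (up e s) = up e (Anc-trans r s)

  Anc-comparable : ∀ {a b z} → Anc par a z → Anc par b z → Anc par a b ⊎ Anc par b a
  Anc-comparable here      rb         = inj₂ rb
  Anc-comparable (up e ra) here       = inj₁ (up e ra)
  Anc-comparable (up e ra) (up e' rb) rewrite par-functional e e' = Anc-comparable ra rb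

  -- The head of an arc u → v descends from the last-born sibling of u.
  Arc-depth : ∀ {u v} → Arc u v → depth u ≤ depth v
  Arc-depth {u} {v} (_ , p , l , _ , pu≡p , lp≡l , l≤v , _) =
    subst (_≤ depth v) (trans (par-depth l p (last-child p l lp≡l)) (sym (par-depth u p pu≡p)))
      (Anc-depth l≤v)

  Above : Fin n → Fin n → Set
  Above t z = Anc par t z × depth t < depth z

  StrictAnc⇒Above : ∀ {t z} → StrictAnc t z → Above t z
  StrictAnc⇒Above (here , t≢z) = ⊥-elim (t≢z refl)
  StrictAnc⇒Above (up e r , _) = up e r , ≤-<-trans (Anc-depth r) (depth-par e)

  Above-outArc : ∀ {t u v} → Above t u → Arc u v → Above t v
  Above-outArc (here , t<t) _ = ⊥-elim (<-irrefl refl t<t)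
  Above-outArc (up pu≡w t≤w , t<u) u→v@(_ , p , l , _ , pu≡p , lp≡l , l≤v , _) =
    Anc-trans (up (last-child p l lp≡l) (subst (Anc par _) (par-functional pu≡w pu≡p) t≤w)) l≤v ,
    <-≤-trans t<u (Arc-depth u→v)

  Above-inArc : ∀ {t u v} → Above t v → Arc u v → Above t u ⊎ Arc u t
  Above-inArc (t≤v , _) (b , p , l , cb≡b , pu≡p , lp≡l , l≤v , v≤b)
    with Anc-comparable t≤v l≤v
  ... | inj₂ l≤t  = inj₂ (b , p , l , cb≡b , pu≡p , lp≡l , l≤t , Anc-trans t≤v v≤b)
  ... | inj₁ here = inj₂ (b , p , l , cb≡b , pu≡p , lp≡l , here , Anc-trans t≤v v≤b)
  ... | inj₁ (up pl≡w t≤w) = inj₁ (up pu≡p t≤p , ≤-<-trans (Anc-depth t≤p) (depth-par pu≡p))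
    where
    t≤p : Anc par _ p
    t≤p = subst (Anc par _) (par-functional pl≡w (last-child p l lp≡l)) t≤w

  Above-Adj : ∀ {t y z} → Above t z → Adj y z → Above t y ⊎ Arc y t
  Above-Adj t≺z (inj₁ y→z) = Above-inArc t≺z y→z
  Above-Adj t≺z (inj₂ z→y) = inj₁ (Above-outArc t≺z z→y)

  Subordinate⇒¬¬Above : ∀ {H x} → Subordinate T H x → ¬ ¬ (∃ λ t → InSeq H t × Above t x)
  Subordinate⇒¬¬Above {x = x} (x∈H , p , a , a' , (_ , _ , _ , S≡pa , _) , x≢p , x≢a , x≢a') noAbove
    with Equivalence.to (S≡pa x) (x∈H , λ y y∈H y<x → noAbove (y , y∈H , StrictAnc⇒Above y<x))
  ... | inj₁ x≡p         = x≢p x≡p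
  ... | inj₂ (inj₁ x≡a)  = x≢a x≡a
  ... | inj₂ (inj₂ x≡a') = x≢a' x≡a'

  Shallower : Seq n → Seq n → Set
  Shallower A B = Σ (Fin (len A)) λ i → ∀ j → depth (vert A i) < depth (vert B j)

  Shallower? : ∀ A B → Dec (Shallower A B)
  Shallower? A B = any? λ i → all? λ j → depth (vert A i) <? depth (vert B j)

  Shallower-asym : ∀ {A B} → Shallower A B → ¬ Shallower B A
  Shallower-asym (i , A<B) (j , B<A) = <-asym (A<B j) (B<A i)

  record Attachment (A P B : Seq n) (x : Fin n) : Set where
    field
      x∈P         : InSeq P x
      P-meets-B   : ∃ λ v → InSeq P v × InSeq B v
      P-steps     : ∀ i j → PathNext (len P) i j → Adj (vert P i) (vert P j)
      B-steps     : ∀ i j → PathNext (len B) i j → Adj (vert B i) (vert B j)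
      x-separates : ∀ {u v} → InSeq A u → InSeq P v ⊎ InSeq B v → Adj v u → u ≡ x ⊎ v ≡ x

  attachment : ∀ {V : Fin n → Set} {A P B x x'} →
    (∀ v → InSeq A v ⊎ InSeq P v ⊎ InSeq B v → V v) →
    (∀ u v → V u → V v → Adj u v ⇔ (CycEdge A u v ⊎ PathEdge P u v ⊎ CycEdge B u v)) →
    InSeq P x → InSeq P x' → InSeq B x' →
    (∀ v → InSeq A v → InSeq P v → v ≡ x) →
    (∀ v → InSeq A v → InSeq B v → v ≡ x) →
    Attachment A P B x
  attachment {V} {A} {P} {B} {x} inV edges x∈P x'∈P x'∈B A∩P A∩B = record
    { x∈P         = x∈P
    ; P-meets-B   = _ , x'∈P , x'∈B
    ; P-steps     = λ i j e → Equivalence.from (edges _ _ (inP i) (inP j)) (inj₂ (inj₁ (i , j , inj₁ e , refl , refl)))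
    ; B-steps     = λ i j e → Equivalence.from (edges _ _ (inB i) (inB j)) (inj₂ (inj₂ (i , j , inj₁ (inj₁ e) , refl , refl)))
    ; x-separates = separates
    }
    where
    inP : ∀ i → V (vert P i)
    inP i = inV _ (inj₂ (inj₁ (i , refl)))
    inB : ∀ i → V (vert B i)
    inB i = inV _ (inj₂ (inj₂ (i , refl)))

    separates : ∀ {u v} → InSeq A u → InSeq P v ⊎ InSeq B v → Adj v u → u ≡ x ⊎ v ≡ x
    separates {u} {v} u∈A v∈PB v~u with Equivalence.to (edges v u (inV v (inj₂ v∈PB)) (inV u (inj₁ u∈A))) v~u
    ... | inj₁ e        = inj₂ ([ A∩P v (proj₁ (CycEdge-ends e)) , A∩B v (proj₁ (CycEdge-ends e)) ]′ v∈PB)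
    ... | inj₂ (inj₁ e) = inj₁ (A∩P u u∈A (proj₂ (PathEdge-ends e)))
    ... | inj₂ (inj₂ e) = inj₁ (A∩B u u∈A (proj₂ (CycEdge-ends e)))

  dumbbell⇒attachments : ∀ {V H P H' x x'} → IsDumbbell T V H P H' x x' →
    Attachment H P H' x × Attachment H' P H x'
  dumbbell⇒attachments {V} {H} {P} {H'} {x} {x'}
    (_ , _ , (_ , m , len≡ , starts , ends) , x∈H , x'∈H' , cover , H∩P , H'∩P , H∩H' , edges) =
    attachment inV edges x∈P x'∈P x'∈H' H∩P (λ v a b → proj₁ (H∩H' v a b)) ,
    attachment (λ v → inV v ∘ mirror) edges' x'∈P x∈P x∈H H'∩P (λ v a b → proj₂ (H∩H' v b a))
    where
    inV : ∀ v → InSeq H v ⊎ InSeq P v ⊎ InSeq H' v → V v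
    inV v = Equivalence.from (cover v)

    edges' : ∀ u v → V u → V v → Adj u v ⇔ (CycEdge H' u v ⊎ PathEdge P u v ⊎ CycEdge H u v)
    edges' u v Vu Vv = mk⇔ (mirror ∘ Equivalence.to (edges u v Vu Vv)) (Equivalence.from (edges u v Vu Vv) ∘ mirror)

    0<len : 0 < len P
    0<len = subst (0 <_) (sym len≡) (s≤s z≤n)
    m<len : m < len P
    m<len = subst (m <_) (sym len≡) (n<1+n m)

    x∈P : InSeq P x
    x∈P = fromℕ< 0<len , starts _ (toℕ-fromℕ< 0<len)
    x'∈P : InSeq P x'
    x'∈P = fromℕ< m<len , ends _ (toℕ-fromℕ< m<len)

  module _ {A P B : Seq n} {x : Fin n} (att : Attachment A P B x)
           {t : Fin n} (t∈A : InSeq A t) (t≺x : Above t x) where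
    open Attachment att

    Above-spreads : ∀ {y z} → InSeq P y ⊎ InSeq B y → Above t z → Adj y z → Above t y
    Above-spreads y∈PB t≺z y~z with Above-Adj t≺z y~z
    ... | inj₁ t≺y = t≺y
    ... | inj₂ y→t with x-separates t∈A y∈PB (inj₁ y→t)
    ...   | inj₁ refl = ⊥-elim (<-irrefl refl (proj₂ t≺x))
    ...   | inj₂ refl = ⊥-elim (<⇒≱ (proj₂ t≺x) (Arc-depth y→t))

    Above-along : (s : Seq n) → (∀ {v} → InSeq s v → InSeq P v ⊎ InSeq B v) →
      (∀ i j → PathNext (len s) i j → Adj (vert s i) (vert s j)) →
      ∀ {v} → InSeq s v → Above t v → ∀ j → Above t (vert s j)
    Above-along s s⊆PB steps (i , refl) =
      spread (λ j → Above t (vert s j))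
        (λ i j e t≺i → Above-spreads (s⊆PB (j , refl)) t≺i (swap (steps i j e)))
        (λ i j e t≺j → Above-spreads (s⊆PB (i , refl)) t≺j (steps i j e))
        i

    Above-all-of-B : ∀ j → Above t (vert B j)
    Above-all-of-B with P-meets-B
    ... | v , (i , refl) , v∈B =
      Above-along B inj₂ B-steps v∈B (Above-along P inj₁ P-steps x∈P t≺x i)

  attachment⇒¬¬Shallower : ∀ {A P B x} → Attachment A P B x → Subordinate T A x → ¬ ¬ Shallower A B
  attachment⇒¬¬Shallower att sub notShallower =
    Subordinate⇒¬¬Above sub λ { (t , (i , refl) , t≺x) →
      notShallower (i , λ j → proj₂ (Above-all-of-B att (i , refl) t≺x j)) }

lemma6p2 : ∀ {n} (T : BurlingTree n) (V : Fin n → Set)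
    (H P H' : Seq n) (x x' : Fin n) →
    IsDumbbell T V H P H' x x' →
    ¬ Subordinate T H x ⊎ ¬ Subordinate T H' x'
lemma6p2 T V H P H' x x' dumbbell
  with dumbbell⇒attachments T dumbbell | Shallower? T H H'
... | _ , H'-side | yes H≺H' =
  inj₂ λ sub' → attachment⇒¬¬Shallower T H'-side sub' (Shallower-asym T H≺H')
... | H-side , _  | no H⊀H' =
  inj₁ λ sub → attachment⇒¬¬Shallower T H-side sub H⊀H'
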